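{- Let $n$ be a positive integer. If $T\subseteq\{0,1\}^n$ is uncrossed, then $|\{x\in T:\ |x| = n/2\}|\le 2$.
   Context: For $x,x'\in\{0,1\}^n$ and $a,b\in\{0,1\}$, let $I_{ab}(x,x')=\{j\in[n]:(x_j,x'_j)=(a,b)\}$. A pair $(x,x')$ is a crossing pair if $I_{ab}(x,x')\ne\emptyset$ for all four choices of $a,b\in\{0,1\}$. A set $T\subseteq\{0,1\}^n$ is crossed if it contains a crossing pair and uncrossed otherwise. The weight $|x|$ of $x\in\{0,1\}^n$ is its number of $1$s. -}

module Defs where

open import Data.Bool using (Bool; true; false; _∧_)
open import Data.Nat using (ℕ; zero; suc; _*_; _≡ᵇ_)
open import Data.Vec using (Vec; []; _∷_; count; zipWith)
open import Data.List as List using (List; concatMap; filterᵇ; length)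
open import Data.Product using (Σ; _×_; _,_; ∃)
open import Relation.Binary.PropositionalEquality using (_≡_)
open import Relation.Nullary using (¬_)
open import Data.Fin using (Fin)
import Data.Vec as Vec

-- A binary vector x ∈ {0,1}^n is a Vec Bool n (true = 1, false = 0).
-- A subset T ⊆ {0,1}^n is given by its characteristic function.
Subset : ℕ → Set
Subset n = Vec Bool n → Bool

weight : ∀ {n} → Vec Bool n → ℕ
weight [] = 0
weight (true ∷ xs) = suc (weight xs)
weight (false ∷ xs) = weight xs

I-nonempty : ∀ {n} → Bool → Bool → Vec Bool n → Vec Bool n → Set
I-nonempty a b x x' = ∃ λ (j : Fin _) → (Vec.lookup x j ≡ a) × (Vec.lookup x' j ≡ b)

CrossingPair : ∀ {n} → Vec Bool n → Vec Bool n → Set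
CrossingPair x x' = ∀ (a b : Bool) → I-nonempty a b x x'

Crossed : ∀ {n} → Subset n → Set
Crossed {n} T = Σ (Vec Bool n) λ x → Σ (Vec Bool n) λ x' →
  (T x ≡ true) × (T x' ≡ true) × CrossingPair x x'

Uncrossed : ∀ {n} → Subset n → Set
Uncrossed T = ¬ Crossed T

allVecs : (n : ℕ) → List (Vec Bool n)
allVecs zero = [] List.∷ List.[]
allVecs (suc n) = concatMap (λ v → (false ∷ v) List.∷ (true ∷ v) List.∷ List.[]) (allVecs n)

-- |{x ∈ T : 2|x| = n}|, i.e. |x| = n/2
middleCount : (n : ℕ) → Subset n → ℕ
middleCount n T = length (filterᵇ (λ x → T x ∧ (2 * weight x ≡ᵇ n)) (allVecs n))

module Submission where

-- Let x, y be members of weight n/2 and write ∣I∣ a b x y for the size of I_ab(x, y).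
-- Equal weights give ∣I₁₀∣ = ∣I₀₁∣, and since the complements have weight n/2 as well,
-- ∣I₁₁∣ = ∣I₀₀∣. A non-crossing pair has an empty class, hence its partner class is empty
-- too, so y = x or y = not x. Three distinct middle members b, c ≠ a would then both equal
-- not a.

open import Defs
open import Data.Bool using (Bool; true; false; not; _∧_; _≟_)
import Data.Bool as Bool
open import Data.Bool.Properties using (T-∧; T-≡)
open import Data.Nat using (ℕ; zero; suc; _+_; _*_; _≤_; _≡ᵇ_; z≤n; s≤s; NonZero)
open import Data.Nat.Properties using (+-suc; +-comm; +-identityʳ; +-cancelˡ-≡; *-cancelˡ-≡; ≡ᵇ⇒≡)
open import Data.Vec using (Vec; []; _∷_; map)
open import Data.Vec.Properties using (∷-injectiveʳ)
open import Data.List as List using (List; length; concatMap)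
open import Data.List.Relation.Unary.All using (All; []; _∷_)
open import Data.List.Relation.Unary.All.Properties using (all-filter)
open import Data.List.Relation.Unary.AllPairs using ([]; _∷_)
open import Data.List.Relation.Unary.Unique.Propositional using (Unique)
import Data.List.Relation.Unary.Unique.Propositional.Properties as Unique
open import Data.Fin using () renaming (zero to fzero; suc to fsuc)
open import Data.Product using (_,_; ∃₂)
open import Data.Sum as Sum using (_⊎_; inj₁; inj₂)
open import Data.Empty using (⊥-elim)
open import Function using (_∘_; id; Equivalence)
open import Relation.Nullary using (¬_; yes; no)
open import Relation.Nullary.Decidable using (T?)
open import Relation.Binary.PropositionalEquality using (_≡_; _≢_; refl; sym; trans; cong; module ≡-Reasoning)

∣I∣ : ∀ {n} → Bool → Bool → Vec Bool n → Vec Bool n → ℕ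
∣I∣ a b []       []       = 0
∣I∣ a b (x ∷ xs) (y ∷ ys) with x ≟ a | y ≟ b
... | yes _ | yes _ = suc (∣I∣ a b xs ys)
... | _     | _     = ∣I∣ a b xs ys

I-nonempty-∷ : ∀ {n a b} {x y} {xs ys : Vec Bool n} → I-nonempty a b xs ys → I-nonempty a b (x ∷ xs) (y ∷ ys)
I-nonempty-∷ (j , xⱼ≡a , yⱼ≡b) = fsuc j , xⱼ≡a , yⱼ≡b

∣I∣≡0⊎I-nonempty : ∀ {n} a b (x y : Vec Bool n) → ∣I∣ a b x y ≡ 0 ⊎ I-nonempty a b x y
∣I∣≡0⊎I-nonempty a b []       []       = inj₁ refl
∣I∣≡0⊎I-nonempty a b (x ∷ xs) (y ∷ ys) with x ≟ a | y ≟ b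
... | yes x≡a | yes y≡b = inj₂ (fzero , x≡a , y≡b)
... | yes _   | no _    = Sum.map₂ I-nonempty-∷ (∣I∣≡0⊎I-nonempty a b xs ys)
... | no _    | _       = Sum.map₂ I-nonempty-∷ (∣I∣≡0⊎I-nonempty a b xs ys)

weight≡∣I₁₁∣+∣I₁₀∣ : ∀ {n} (x y : Vec Bool n) → weight x ≡ ∣I∣ true true x y + ∣I∣ true false x y
weight≡∣I₁₁∣+∣I₁₀∣ []           []           = refl
weight≡∣I₁₁∣+∣I₁₀∣ (true  ∷ xs) (true  ∷ ys) = cong suc (weight≡∣I₁₁∣+∣I₁₀∣ xs ys)
weight≡∣I₁₁∣+∣I₁₀∣ (true  ∷ xs) (false ∷ ys) = trans (cong suc (weight≡∣I₁₁∣+∣I₁₀∣ xs ys)) (sym (+-suc _ _))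
weight≡∣I₁₁∣+∣I₁₀∣ (false ∷ xs) (_     ∷ ys) = weight≡∣I₁₁∣+∣I₁₀∣ xs ys

weight≡∣I₁₁∣+∣I₀₁∣ : ∀ {n} (x y : Vec Bool n) → weight y ≡ ∣I∣ true true x y + ∣I∣ false true x y
weight≡∣I₁₁∣+∣I₀₁∣ []           []           = refl
weight≡∣I₁₁∣+∣I₀₁∣ (true  ∷ xs) (true  ∷ ys) = cong suc (weight≡∣I₁₁∣+∣I₀₁∣ xs ys)
weight≡∣I₁₁∣+∣I₀₁∣ (false ∷ xs) (true  ∷ ys) = trans (cong suc (weight≡∣I₁₁∣+∣I₀₁∣ xs ys)) (sym (+-suc _ _))
weight≡∣I₁₁∣+∣I₀₁∣ (true  ∷ xs) (false ∷ ys) = weight≡∣I₁₁∣+∣I₀₁∣ xs ys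
weight≡∣I₁₁∣+∣I₀₁∣ (false ∷ xs) (false ∷ ys) = weight≡∣I₁₁∣+∣I₀₁∣ xs ys

weight-not≡∣I₀₁∣+∣I₀₀∣ : ∀ {n} (x y : Vec Bool n) → weight (map not x) ≡ ∣I∣ false true x y + ∣I∣ false false x y
weight-not≡∣I₀₁∣+∣I₀₀∣ []           []           = refl
weight-not≡∣I₀₁∣+∣I₀₀∣ (false ∷ xs) (true  ∷ ys) = cong suc (weight-not≡∣I₀₁∣+∣I₀₀∣ xs ys)
weight-not≡∣I₀₁∣+∣I₀₀∣ (false ∷ xs) (false ∷ ys) = trans (cong suc (weight-not≡∣I₀₁∣+∣I₀₀∣ xs ys)) (sym (+-suc _ _))
weight-not≡∣I₀₁∣+∣I₀₀∣ (true  ∷ xs) (_     ∷ ys) = weight-not≡∣I₀₁∣+∣I₀₀∣ xs ys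

weight+weight-not≡length : ∀ {n} (x : Vec Bool n) → weight x + weight (map not x) ≡ n
weight+weight-not≡length []           = refl
weight+weight-not≡length (true  ∷ xs) = cong suc (weight+weight-not≡length xs)
weight+weight-not≡length (false ∷ xs) = trans (+-suc _ _) (cong suc (weight+weight-not≡length xs))

∣I₁₀∣≡0∧∣I₀₁∣≡0⇒≡ : ∀ {n} (x y : Vec Bool n) → ∣I∣ true false x y ≡ 0 → ∣I∣ false true x y ≡ 0 → x ≡ y
∣I₁₀∣≡0∧∣I₀₁∣≡0⇒≡ []           []           _  _  = refl
∣I₁₀∣≡0∧∣I₀₁∣≡0⇒≡ (true  ∷ xs) (true  ∷ ys) p q = cong (true ∷_) (∣I₁₀∣≡0∧∣I₀₁∣≡0⇒≡ xs ys p q)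
∣I₁₀∣≡0∧∣I₀₁∣≡0⇒≡ (false ∷ xs) (false ∷ ys) p q = cong (false ∷_) (∣I₁₀∣≡0∧∣I₀₁∣≡0⇒≡ xs ys p q)
∣I₁₀∣≡0∧∣I₀₁∣≡0⇒≡ (true  ∷ xs) (false ∷ ys) () _
∣I₁₀∣≡0∧∣I₀₁∣≡0⇒≡ (false ∷ xs) (true  ∷ ys) _  ()

∣I₁₁∣≡0∧∣I₀₀∣≡0⇒≡not : ∀ {n} (x y : Vec Bool n) → ∣I∣ true true x y ≡ 0 → ∣I∣ false false x y ≡ 0 → y ≡ map not x
∣I₁₁∣≡0∧∣I₀₀∣≡0⇒≡not []           []           _  _  = refl
∣I₁₁∣≡0∧∣I₀₀∣≡0⇒≡not (true  ∷ xs) (false ∷ ys) p q = cong (false ∷_) (∣I₁₁∣≡0∧∣I₀₀∣≡0⇒≡not xs ys p q)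
∣I₁₁∣≡0∧∣I₀₀∣≡0⇒≡not (false ∷ xs) (true  ∷ ys) p q = cong (true ∷_) (∣I₁₁∣≡0∧∣I₀₀∣≡0⇒≡not xs ys p q)
∣I₁₁∣≡0∧∣I₀₀∣≡0⇒≡not (true  ∷ xs) (true  ∷ ys) () _
∣I₁₁∣≡0∧∣I₀₀∣≡0⇒≡not (false ∷ xs) (false ∷ ys) _  ()

middle-weight⇒weight-not≡weight : ∀ {n} (x : Vec Bool n) → 2 * weight x ≡ n → weight (map not x) ≡ weight x
middle-weight⇒weight-not≡weight x 2w≡n = +-cancelˡ-≡ (weight x) _ _ (begin
  weight x + weight (map not x) ≡⟨ weight+weight-not≡length x ⟩
  _                             ≡⟨ sym 2w≡n ⟩
  weight x + (weight x + 0)     ≡⟨ cong (weight x +_) (+-identityʳ (weight x)) ⟩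
  weight x + weight x           ∎)
  where open ≡-Reasoning

module _ {n} (x y : Vec Bool n) (wx≡wy : weight x ≡ weight y) where
  private
    ∣I₁₁∣ = ∣I∣ true true x y
    ∣I₁₀∣ = ∣I∣ true false x y
    ∣I₀₁∣ = ∣I∣ false true x y
    ∣I₀₀∣ = ∣I∣ false false x y

  equal-weights⇒∣I₁₀∣≡∣I₀₁∣ : ∣I₁₀∣ ≡ ∣I₀₁∣
  equal-weights⇒∣I₁₀∣≡∣I₀₁∣ = +-cancelˡ-≡ ∣I₁₁∣ _ _ (begin
    ∣I₁₁∣ + ∣I₁₀∣ ≡⟨ sym (weight≡∣I₁₁∣+∣I₁₀∣ x y) ⟩
    weight x      ≡⟨ wx≡wy ⟩
    weight y      ≡⟨ weight≡∣I₁₁∣+∣I₀₁∣ x y ⟩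
    ∣I₁₁∣ + ∣I₀₁∣ ∎)
    where open ≡-Reasoning

  equal-weights⇒∣I₁₁∣≡∣I₀₀∣ : weight (map not x) ≡ weight x → ∣I₁₁∣ ≡ ∣I₀₀∣
  equal-weights⇒∣I₁₁∣≡∣I₀₀∣ w¬x≡wx = sym (+-cancelˡ-≡ ∣I₁₀∣ _ _ (begin
    ∣I₁₀∣ + ∣I₀₀∣      ≡⟨ cong (_+ ∣I₀₀∣) equal-weights⇒∣I₁₀∣≡∣I₀₁∣ ⟩
    ∣I₀₁∣ + ∣I₀₀∣      ≡⟨ sym (weight-not≡∣I₀₁∣+∣I₀₀∣ x y) ⟩
    weight (map not x) ≡⟨ w¬x≡wx ⟩
    weight x           ≡⟨ weight≡∣I₁₁∣+∣I₁₀∣ x y ⟩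
    ∣I₁₁∣ + ∣I₁₀∣      ≡⟨ +-comm ∣I₁₁∣ ∣I₁₀∣ ⟩
    ∣I₁₀∣ + ∣I₁₁∣      ∎))
    where open ≡-Reasoning

non-crossing⇒∣I∣≡0 : ∀ {n} (x y : Vec Bool n) → ¬ CrossingPair x y → ∃₂ λ a b → ∣I∣ a b x y ≡ 0
non-crossing⇒∣I∣≡0 x y ¬cross
  with ∣I∣≡0⊎I-nonempty true true x y | ∣I∣≡0⊎I-nonempty true false x y
     | ∣I∣≡0⊎I-nonempty false true x y | ∣I∣≡0⊎I-nonempty false false x y
... | inj₁ z  | _       | _       | _      = true , true , z
... | inj₂ _  | inj₁ z  | _       | _      = true , false , z
... | inj₂ _  | inj₂ _  | inj₁ z  | _      = false , true , z
... | inj₂ _  | inj₂ _  | inj₂ _  | inj₁ z = false , false , z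
... | inj₂ i₁₁ | inj₂ i₁₀ | inj₂ i₀₁ | inj₂ i₀₀ = ⊥-elim (¬cross λ
  { true true → i₁₁ ; true false → i₁₀ ; false true → i₀₁ ; false false → i₀₀ })

non-crossing-middle-pair : ∀ {n} (x y : Vec Bool n) → ¬ CrossingPair x y →
  2 * weight x ≡ n → 2 * weight y ≡ n → x ≡ y ⊎ y ≡ map not x
non-crossing-middle-pair x y ¬cross 2wx≡n 2wy≡n = from-empty-class (non-crossing⇒∣I∣≡0 x y ¬cross)
  where
  wx≡wy : weight x ≡ weight y
  wx≡wy = *-cancelˡ-≡ (weight x) (weight y) 2 (trans 2wx≡n (sym 2wy≡n))
  ∣I₁₀∣≡∣I₀₁∣ : ∣I∣ true false x y ≡ ∣I∣ false true x y
  ∣I₁₀∣≡∣I₀₁∣ = equal-weights⇒∣I₁₀∣≡∣I₀₁∣ x y wx≡wy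
  ∣I₁₁∣≡∣I₀₀∣ : ∣I∣ true true x y ≡ ∣I∣ false false x y
  ∣I₁₁∣≡∣I₀₀∣ = equal-weights⇒∣I₁₁∣≡∣I₀₀∣ x y wx≡wy (middle-weight⇒weight-not≡weight x 2wx≡n)

  from-empty-class : (∃₂ λ a b → ∣I∣ a b x y ≡ 0) → x ≡ y ⊎ y ≡ map not x
  from-empty-class (true  , true  , z) = inj₂ (∣I₁₁∣≡0∧∣I₀₀∣≡0⇒≡not x y z (trans (sym ∣I₁₁∣≡∣I₀₀∣) z))
  from-empty-class (false , false , z) = inj₂ (∣I₁₁∣≡0∧∣I₀₀∣≡0⇒≡not x y (trans ∣I₁₁∣≡∣I₀₀∣ z) z)
  from-empty-class (true  , false , z) = inj₁ (∣I₁₀∣≡0∧∣I₀₁∣≡0⇒≡ x y z (trans (sym ∣I₁₀∣≡∣I₀₁∣) z))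
  from-empty-class (false , true  , z) = inj₁ (∣I₁₀∣≡0∧∣I₀₁∣≡0⇒≡ x y (trans ∣I₁₀∣≡∣I₀₁∣ z) z)

unique-length≤2 : ∀ {A : Set} {P : A → Set} (f : A → A) → (∀ {u v} → P u → P v → u ≡ v ⊎ v ≡ f u) →
  ∀ {l} → All P l → Unique l → length l ≤ 2
unique-length≤2 f related {List.[]}                   _ _ = z≤n
unique-length≤2 f related {_ List.∷ List.[]}          _ _ = s≤s z≤n
unique-length≤2 f related {_ List.∷ _ List.∷ List.[]} _ _ = s≤s (s≤s z≤n)
unique-length≤2 {P = P} f related {_ List.∷ _ List.∷ _ List.∷ _}
  (pa ∷ pb ∷ pc ∷ _) ((a≢b ∷ a≢c ∷ _) ∷ (b≢c ∷ _) ∷ _) =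
  ⊥-elim (b≢c (trans (image pa pb a≢b) (sym (image pa pc a≢c))))
  where
  image : ∀ {u v} → P u → P v → u ≢ v → v ≡ f u
  image pu pv u≢v = Sum.[ ⊥-elim ∘ u≢v , id ] (related pu pv)

extensions : ∀ {n} → Vec Bool n → List (Vec Bool (suc n))
extensions v = (false ∷ v) List.∷ (true ∷ v) List.∷ List.[]

concatMap-extensions⁺ : ∀ {n} {vs : List (Vec Bool n)} → Unique vs → Unique (concatMap extensions vs)
concatMap-extensions⁺ []           = []
concatMap-extensions⁺ (v∉vs ∷ vs!) =
  ((λ ()) ∷ extensions-fresh false v∉vs) ∷ extensions-fresh true v∉vs ∷ concatMap-extensions⁺ vs!
  where
  extensions-fresh : ∀ {n} b {v : Vec Bool n} {ws} → All (v ≢_) ws → All ((b ∷ v) ≢_) (concatMap extensions ws)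
  extensions-fresh b []           = []
  extensions-fresh b (v≢w ∷ v∉ws) = (v≢w ∘ ∷-injectiveʳ) ∷ (v≢w ∘ ∷-injectiveʳ) ∷ extensions-fresh b v∉ws

allVecs-unique : ∀ n → Unique (allVecs n)
allVecs-unique zero    = [] ∷ []
allVecs-unique (suc n) = concatMap-extensions⁺ (allVecs-unique n)

lemma3p3 : (n : ℕ) → .{{_ : NonZero n}} → (T : Subset n) → Uncrossed T →
    middleCount n T ≤ 2
lemma3p3 n T uncrossed =
  unique-length≤2 (map not) middle-related (all-filter (T? ∘ middle) (allVecs n))
    (Unique.filter⁺ (T? ∘ middle) (allVecs-unique n))
  where
  middle : Vec Bool n → Bool
  middle x = T x ∧ (2 * weight x ≡ᵇ n)

  middle-related : ∀ {x y} → Bool.T (middle x) → Bool.T (middle y) → x ≡ y ⊎ y ≡ map not x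
  middle-related {x} {y} mx my with Equivalence.to T-∧ mx | Equivalence.to T-∧ my
  ... | Tx , 2wx≡n | Ty , 2wy≡n =
    non-crossing-middle-pair x y
      (λ cross → uncrossed (x , y , Equivalence.to T-≡ Tx , Equivalence.to T-≡ Ty , cross))
      (≡ᵇ⇒≡ _ _ 2wx≡n) (≡ᵇ⇒≡ _ _ 2wy≡n)
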